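{- Let $\varphi$ be a CNF formula in which every clause consists of three literals and every variable occurs in two or three clauses, let $G=G(\varphi)$ be the graph constructed below, and let $\prec$ be an elimination order for $G$. Let $c=l_1\lor l_2\lor l_3$ be a clause of $\varphi$ and let $v$ be the $\prec$-first vertex of $\mathrm{Clause}(c)$. Then either $\gamma\prec v$, or there is $l\in\{l_1,l_2,l_3\}$ such that every vertex $y$ of $\mathrm{Var}(l)$ with $N_G(y)\supseteq N_G(r_l)$, where $r_l$ is the representative of $l$, satisfies $y\prec v$.
   Context: Construction of $G(\varphi)$. For each variable $v$ occurring in $p$ clauses, of which $b$ contain the literal $v$ and $a$ contain $\neg v$ ($a+b=p$), the variable gadget $\mathrm{Var}(v)$ is an independent set of $2p+1$ vertices: $v_0$ (representative of $\neg v$), $v_1$ (representative of $v$), and transition vertices $t_1,\dots,t_{2p-1}$; $\mathrm{Var}(l)$ denotes $\mathrm{Var}(v)$ for a literal $l$ of $v$. For each clause $c=l_1\lor l_2\lor l_3$, the clause gadget $\mathrm{Clause}(c)$ is a clique on five vertices $c_\top, c_{l_1}, c_{l_2}, c_{l_3}, c_\bot$. Add two further vertices $\gamma$ and $\iota$. Edges: (1) for each clause $c=l_1\lor l_2\lor l_3$ and $i\in[3]$, both $c_{l_i}$ and $c_\top$ are joined to the representative of $l_i$; (2) each $c_\bot$ is joined to $\gamma$; (3) for each variable $v$: after (1), $N(v_0)=\{x_1,\dots,x_{2a}\}$ is ordered so that $x_1,\dots,x_a$ are of the form $c_\top$ and $x_{a+1},\dots,x_{2a}$ of the form $c_{l}$;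 $N(v_1)=\{y_1,\dots,y_{2b}\}$ is ordered so that $y_1,\dots,y_b$ are of the form $c_l$ and $y_{b+1},\dots,y_{2b}$ of the form $c_\top$; set $N(t_1)=N(v_0)\cup\{y_1\}$, $N(t_i)=N(t_{i-1})\cup\{y_i\}$ for $i\in[2,2b]$, and $N(t_i)=N(t_{i-1})\setminus\{x_{i-2b}\}$ for $i\in[2b+1,2a+2b-1]$. The vertex $\iota$ is isolated. No other edges. Two distinct vertices $u,v$ of a graph $H$ are $1$-twins if $|(N_H(u)\setminus N_H[v])\cup(N_H(v)\setminus N_H[u])|\le 1$. An elimination order of $G$ is a total order $\prec$ on $V(G)$, listing $V(G)$ as $u_1\prec\dots\prec u_N$, such that for each $i\in[N-1]$, $u_i$ has a $1$-twin in $G-\{u_1,\dots,u_{i-1}\}$. -}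

module Defs where

open import Data.Nat using (ℕ; zero; suc; _+_; _*_; _∸_; _≤_; _<_)
open import Data.Fin using (Fin; toℕ)
open import Data.Bool using (Bool; true; false; if_then_else_; _∨_; _∧_)
open import Data.Product using (Σ; ∃; ∃-syntax; _×_; _,_; proj₁; proj₂)
open import Data.Sum using (_⊎_)
open import Relation.Nullary using (¬_)
open import Relation.Nullary.Decidable using (⌊_⌋)
open import Relation.Binary.PropositionalEquality using (_≡_; _≢_)
import Data.Fin as F
import Data.Bool as B

SymDiff : {V : Set} → (V → V → Set) → (V → Set) → V → V → V → Set
SymDiff Adj R u w z =
  R z × z ≢ u × z ≢ w × ((Adj z u × ¬ Adj z w) ⊎ (Adj z w × ¬ Adj z u))

OneTwins : {V : Set} → (V → V → Set) → (V → Set) → V → V → Set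
OneTwins Adj R u w =
  R u × R w × u ≢ w ×
  (∀ z z' → SymDiff Adj R u w z → SymDiff Adj R u w z' → z ≡ z')

-- A total order on V given by an injective rank function: u ≺ w iff rank u < rank w.
-- It is an elimination order if every vertex u other than the last one has a
-- 1-twin in G - {vertices before u}, i.e. in the subgraph induced on
-- {z | rank u ≤ rank z}.
IsEliminationOrder : {V : Set} → (V → V → Set) → (V → ℕ) → Set
IsEliminationOrder {V} Adj rank =
  (∀ u w → rank u ≡ rank w → u ≡ w) ×
  (∀ u → (∃[ z ] rank u < rank z) →
     ∃[ w ] OneTwins Adj (λ z → rank u ≤ rank z) u w)

-- A literal: a variable together with a polarity (true = v, false = ¬v).
Literal : ℕ → Set
Literal n = Fin n × Bool

record CNF3 : Set where
  field
    nvars    : ℕ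
    nclauses : ℕ
    lit      : Fin nclauses → Fin 3 → Literal nvars

module _ (φ : CNF3) where
  open CNF3 φ

  var : Literal nvars → Fin nvars
  var (x , _) = x

  countᶠ : ∀ {k} → (Fin k → Bool) → ℕ
  countᶠ {zero}  P = zero
  countᶠ {suc k} P = (if P F.zero then 1 else 0) + countᶠ (λ i → P (F.suc i))

  anyᶠ : ∀ {k} → (Fin k → Bool) → Bool
  anyᶠ {zero}  P = false
  anyᶠ {suc k} P = P F.zero ∨ anyᶠ (λ i → P (F.suc i))

  containsᵇ : Fin nclauses → Fin nvars → Bool → Bool
  containsᵇ c x s = anyᶠ (λ i → ⌊ proj₁ (lit c i) F.≟ x ⌋ ∧ ⌊ proj₂ (lit c i) B.≟ s ⌋)

  bOcc aOcc pOcc : Fin nvars → ℕ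
  bOcc x = countᶠ (λ c → containsᵇ c x true)
  aOcc x = countᶠ (λ c → containsᵇ c x false)
  pOcc x = aOcc x + bOcc x

  DistinctVars : Set
  DistinctVars = ∀ c i j → var (lit c i) ≡ var (lit c j) → i ≡ j

  OccursTwoOrThree : Set
  OccursTwoOrThree = ∀ x → pOcc x ≡ 2 ⊎ pOcc x ≡ 3

  data Vtx : Set where
    v₀ v₁ : Fin nvars → Vtx                          -- representatives of ¬x and x
    tr    : (x : Fin nvars) → Fin (2 * pOcc x ∸ 1) → Vtx   -- tr x k = t_{k+1}
    c⊤ c⊥ : Fin nclauses → Vtx
    cL    : Fin nclauses → Fin 3 → Vtx              -- cL c i = c_{l_i}
    γ ι   : Vtx

  rep : Literal nvars → Vtx
  rep (x , true)  = v₁ x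
  rep (x , false) = v₀ x

  data InClause (c : Fin nclauses) : Vtx → Set where
    in⊤ : InClause c (c⊤ c)
    in⊥ : InClause c (c⊥ c)
    inL : ∀ i → InClause c (cL c i)

  data InVar (x : Fin nvars) : Vtx → Set where
    in₀ : InVar x (v₀ x)
    in₁ : InVar x (v₁ x)
    inT : ∀ k → InVar x (tr x k)

  data Edge1 : Vtx → Vtx → Set where
    e-lit : ∀ c i → Edge1 (cL c i) (rep (lit c i))
    e-top : ∀ c i → Edge1 (c⊤ c) (rep (lit c i))

  IsTop IsLitV : Vtx → Set
  IsTop w   = ∃[ c ] w ≡ c⊤ c
  IsLitV w  = ∃[ c ] ∃[ i ] w ≡ cL c i

  -- Admissible orderings x_1..x_{2a} of N(v₀) and y_1..y_{2b} of N(v₁)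
  -- (neighbourhoods after step (1)); index j : Fin _ stands for x_{j+1} / y_{j+1}.
  record ValidOrderings
      (xs : (x : Fin nvars) → Fin (2 * aOcc x) → Vtx)
      (ys : (x : Fin nvars) → Fin (2 * bOcc x) → Vtx) : Set where
    field
      xs-inj  : ∀ x j j' → xs x j ≡ xs x j' → j ≡ j'
      xs-onto : ∀ x w → Edge1 w (v₀ x) → ∃[ j ] xs x j ≡ w
      xs-nbr  : ∀ x j → Edge1 (xs x j) (v₀ x)
      xs-top  : ∀ x j → toℕ j < aOcc x → IsTop (xs x j)
      xs-lit  : ∀ x j → aOcc x ≤ toℕ j → IsLitV (xs x j)
      ys-inj  : ∀ x j j' → ys x j ≡ ys x j' → j ≡ j'
      ys-onto : ∀ x w → Edge1 w (v₁ x) → ∃[ j ] ys x j ≡ w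
      ys-nbr  : ∀ x j → Edge1 (ys x j) (v₁ x)
      ys-lit  : ∀ x j → toℕ j < bOcc x → IsLitV (ys x j)
      ys-top  : ∀ x j → bOcc x ≤ toℕ j → IsTop (ys x j)

  module _ (xs : (x : Fin nvars) → Fin (2 * aOcc x) → Vtx)
           (ys : (x : Fin nvars) → Fin (2 * bOcc x) → Vtx) where

    data Edge : Vtx → Vtx → Set where
      e-clique : ∀ c u w → InClause c u → InClause c w → u ≢ w → Edge u w
      e-one    : ∀ u w → Edge1 u w → Edge u w
      e-bot    : ∀ c → Edge (c⊥ c) γ
      -- (3): x_{j+1} ∈ N(t_{k+1}) iff k+1 ≤ 2b or j+1 > (k+1) - 2b
      e-tx     : ∀ x k j → toℕ k < toℕ j + 2 * bOcc x → Edge (tr x k) (xs x j)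
      -- (3): y_{j+1} ∈ N(t_{k+1}) iff j+1 ≤ k+1
      e-ty     : ∀ x k j → toℕ j ≤ toℕ k → Edge (tr x k) (ys x j)

    Adj : Vtx → Vtx → Set
    Adj u w = Edge u w ⊎ Edge w u

-- If γ is still present when v is eliminated, the 1-twin w of v lives in a graph containing all
-- of Clause(c) and γ. As Clause(c) is a clique, w lies in Clause(c) (otherwise three clause
-- vertices would miss w and two of them would be private neighbours of v). If c⊥ is one of the
-- twins, γ is their unique private neighbour, so every remaining vertex of Var(l) adjacent to the
-- other twin, in particular every dominator of the representative of l, is already eliminated.
-- Otherwise the twins separate two literals on distinct variables; remaining neighbours in the two
-- variable gadgets would be two private neighbours, so one gadget has none.
module Submission where

open import Defs
open import Level using (0ℓ)
open import Data.Nat using (ℕ; _≤_; _<_; _*_; _+_; _∸_; _≤?_; _<?_)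
open import Data.Nat.Properties using (≰⇒>; ≮⇒≥; ≤∧≢⇒<)
open import Data.Fin using (Fin; toℕ; zero; suc)
import Data.Fin as Fin
open import Data.Fin.Properties using (any?)
open import Data.Bool using (Bool; true; false)
import Data.Bool as Bool
open import Data.Product using (Σ; ∃-syntax; _×_; _,_; proj₂; map₂)
import Data.Product.Properties as Product
open import Data.Sum using (_⊎_; inj₁; inj₂)
import Data.Sum.Properties as Sum
open import Data.Empty using (⊥; ⊥-elim)
open import Function using (_∘_)
open import Relation.Nullary using (¬_; Dec; yes; no)
open import Relation.Nullary.Decidable using (map′; _×-dec_; _⊎-dec_)
open import Relation.Unary using (Pred; _∈_; _∉_; _⊆_; _∩_; Empty; Satisfiable; Decidable)
open import Relation.Binary.Definitions using (DecidableEquality)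
open import Relation.Binary.PropositionalEquality using (_≡_; _≢_; refl; sym; trans; cong; subst)

AtMostOne : {V : Set} → Pred V 0ℓ → Set
AtMostOne P = ∀ {z z'} → z ∈ P → z' ∈ P → z ≡ z'

module _ {V : Set} {P : Pred V 0ℓ} (P-atMostOne : AtMostOne P) where

  ⊆-atMostOne-∌⇒Empty : {S : Pred V 0ℓ} {g : V} → g ∈ P → g ∉ S → S ⊆ P → Empty S
  ⊆-atMostOne-∌⇒Empty {S} g∈P g∉S S⊆P y y∈S =
    g∉S (subst (_∈ S) (P-atMostOne (S⊆P y∈S) g∈P) y∈S)

  disjoint-⊆-atMostOne⇒Empty : {S₁ S₂ : Pred V 0ℓ} → Dec (Satisfiable S₁) → (∀ {y} → y ∈ S₁ → y ∉ S₂) →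
    S₁ ⊆ P → S₂ ⊆ P → Empty S₁ ⊎ Empty S₂
  disjoint-⊆-atMostOne⇒Empty (no ¬S₁) _ _ _ = inj₁ λ y y∈S₁ → ¬S₁ (y , y∈S₁)
  disjoint-⊆-atMostOne⇒Empty {S₂ = S₂} (yes (y₁ , y₁∈S₁)) disjoint S₁⊆P S₂⊆P = inj₂ λ y y∈S₂ →
    disjoint y₁∈S₁ (subst (_∈ S₂) (P-atMostOne (S₂⊆P y∈S₂) (S₁⊆P y₁∈S₁)) y∈S₂)

∉∈⇒≢ : {V : Set} {P : Pred V 0ℓ} {z u : V} → z ∉ P → u ∈ P → z ≢ u
∉∈⇒≢ z∉P u∈P refl = z∉P u∈P

module SymDiffProperties {V : Set} {Adj : V → V → Set} {R : Pred V 0ℓ} where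

  SymDiff-swap : ∀ {u w z} → SymDiff Adj R u w z → SymDiff Adj R w u z
  SymDiff-swap (z∈R , z≢u , z≢w , inj₁ onlyU) = z∈R , z≢w , z≢u , inj₂ onlyU
  SymDiff-swap (z∈R , z≢u , z≢w , inj₂ onlyW) = z∈R , z≢w , z≢u , inj₁ onlyW

  OneTwins⇒AtMostOne : ∀ {u w} → OneTwins Adj R u w → AtMostOne (SymDiff Adj R u w)
  OneTwins⇒AtMostOne (_ , _ , _ , unique) = unique _ _

module Vertices (φ : CNF3) where
  open CNF3 φ

  private
    Code : Set
    Code = Fin nvars ⊎ Fin nvars ⊎ Σ (Fin nvars) (λ x → Fin (2 * pOcc φ x ∸ 1))
         ⊎ Fin nclauses ⊎ Fin nclauses ⊎ (Fin nclauses × Fin 3) ⊎ Bool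

    encode : Vtx φ → Code
    encode (v₀ x)   = inj₁ x
    encode (v₁ x)   = inj₂ (inj₁ x)
    encode (tr x k) = inj₂ (inj₂ (inj₁ (x , k)))
    encode (c⊤ c)   = inj₂ (inj₂ (inj₂ (inj₁ c)))
    encode (c⊥ c)   = inj₂ (inj₂ (inj₂ (inj₂ (inj₁ c))))
    encode (cL c i) = inj₂ (inj₂ (inj₂ (inj₂ (inj₂ (inj₁ (c , i))))))
    encode γ        = inj₂ (inj₂ (inj₂ (inj₂ (inj₂ (inj₂ true)))))
    encode ι        = inj₂ (inj₂ (inj₂ (inj₂ (inj₂ (inj₂ false)))))

    decode : Code → Vtx φ
    decode (inj₁ x)                                             = v₀ x
    decode (inj₂ (inj₁ x))                                      = v₁ x
    decode (inj₂ (inj₂ (inj₁ (x , k))))                         = tr x k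
    decode (inj₂ (inj₂ (inj₂ (inj₁ c))))                        = c⊤ c
    decode (inj₂ (inj₂ (inj₂ (inj₂ (inj₁ c)))))                 = c⊥ c
    decode (inj₂ (inj₂ (inj₂ (inj₂ (inj₂ (inj₁ (c , i)))))))    = cL c i
    decode (inj₂ (inj₂ (inj₂ (inj₂ (inj₂ (inj₂ true))))))       = γ
    decode (inj₂ (inj₂ (inj₂ (inj₂ (inj₂ (inj₂ false))))))      = ι

    decode∘encode : ∀ u → decode (encode u) ≡ u
    decode∘encode (v₀ _)   = refl
    decode∘encode (v₁ _)   = refl
    decode∘encode (tr _ _) = refl
    decode∘encode (c⊤ _)   = refl
    decode∘encode (c⊥ _)   = refl
    decode∘encode (cL _ _) = refl
    decode∘encode γ        = refl
    decode∘encode ι        = refl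

    _≟ᶜ_ : DecidableEquality Code
    _≟ᶜ_ = Sum.≡-dec Fin._≟_ (Sum.≡-dec Fin._≟_ (Sum.≡-dec (Product.≡-dec Fin._≟_ Fin._≟_)
             (Sum.≡-dec Fin._≟_ (Sum.≡-dec Fin._≟_ (Sum.≡-dec (Product.≡-dec Fin._≟_ Fin._≟_) Bool._≟_)))))

  infix 4 _≟_
  _≟_ : DecidableEquality (Vtx φ)
  u ≟ w = map′ encode-injective (cong encode) (encode u ≟ᶜ encode w)
    where
    encode-injective : encode u ≡ encode w → u ≡ w
    encode-injective eq = trans (sym (decode∘encode u)) (trans (cong decode eq) (decode∘encode w))

module Graph (φ : CNF3)
  (xs : (x : Fin (CNF3.nvars φ)) → Fin (2 * aOcc φ x) → Vtx φ)
  (ys : (x : Fin (CNF3.nvars φ)) → Fin (2 * bOcc φ x) → Vtx φ)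
  (orderings : ValidOrderings φ xs ys) where
  open CNF3 φ
  open ValidOrderings orderings
  open Vertices φ

  Clause : Fin nclauses → Pred (Vtx φ) 0ℓ
  Clause = InClause φ

  Var : Fin nvars → Pred (Vtx φ) 0ℓ
  Var = InVar φ

  infix 4 _~_
  _~_ : Vtx φ → Vtx φ → Set
  _~_ = Adj φ xs ys

  ~-sym : ∀ {u w} → u ~ w → w ~ u
  ~-sym (inj₁ e) = inj₂ e
  ~-sym (inj₂ e) = inj₁ e

  rep∈Var : ∀ l → rep φ l ∈ Var (var φ l)
  rep∈Var (_ , true)  = in₁
  rep∈Var (_ , false) = in₀

  rep∈Var⇒var≡ : ∀ {x} l → rep φ l ∈ Var x → var φ l ≡ x
  rep∈Var⇒var≡ (_ , true)  in₁ = refl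
  rep∈Var⇒var≡ (_ , false) in₀ = refl

  Var-unique : ∀ {x x' y} → y ∈ Var x → y ∈ Var x' → x ≡ x'
  Var-unique in₀     in₀     = refl
  Var-unique in₁     in₁     = refl
  Var-unique (inT _) (inT _) = refl

  Clause-unique : ∀ {c c' u} → u ∈ Clause c → u ∈ Clause c' → c ≡ c'
  Clause-unique in⊤     in⊤     = refl
  Clause-unique in⊥     in⊥     = refl
  Clause-unique (inL _) (inL _) = refl

  Var∩Clause-empty : ∀ {x c y} → y ∈ Var x → y ∉ Clause c
  Var∩Clause-empty in₀     ()
  Var∩Clause-empty in₁     ()
  Var∩Clause-empty (inT _) ()

  Var≢Clause : ∀ {x c y u} → y ∈ Var x → u ∈ Clause c → y ≢ u
  Var≢Clause y∈Var = ∉∈⇒≢ (Var∩Clause-empty y∈Var)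

  cL-injective : ∀ {c i j} → cL {φ} c i ≡ cL c j → i ≡ j
  cL-injective refl = refl

  Clause-other : ∀ {c u} → u ∈ Clause c → ∃[ z ] z ∈ Clause c × z ≢ u
  Clause-other in⊤     = c⊥ _ , in⊥ , λ ()
  Clause-other in⊥     = c⊤ _ , in⊤ , λ ()
  Clause-other (inL _) = c⊤ _ , in⊤ , λ ()

  Var-or-not : ∀ w → (∃[ x ] w ∈ Var x) ⊎ (∀ {x} → w ∉ Var x)
  Var-or-not (v₀ x)   = inj₁ (x , in₀)
  Var-or-not (v₁ x)   = inj₁ (x , in₁)
  Var-or-not (tr x k) = inj₁ (x , inT k)
  Var-or-not (c⊤ _)   = inj₂ λ ()
  Var-or-not (c⊥ _)   = inj₂ λ ()
  Var-or-not (cL _ _) = inj₂ λ ()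
  Var-or-not γ        = inj₂ λ ()
  Var-or-not ι        = inj₂ λ ()

  Clause? : ∀ c w → Dec (w ∈ Clause c)
  Clause? c w = map′ to from (w ≟ c⊤ c ⊎-dec w ≟ c⊥ c ⊎-dec any? (λ i → w ≟ cL c i))
    where
    to : w ≡ c⊤ c ⊎ w ≡ c⊥ c ⊎ ∃[ i ] w ≡ cL c i → w ∈ Clause c
    to (inj₁ refl)              = in⊤
    to (inj₂ (inj₁ refl))       = in⊥
    to (inj₂ (inj₂ (i , refl))) = inL i
    from : w ∈ Clause c → w ≡ c⊤ c ⊎ w ≡ c⊥ c ⊎ ∃[ i ] w ≡ cL c i
    from in⊤     = inj₁ refl
    from in⊥     = inj₂ (inj₁ refl)
    from (inL i) = inj₂ (inj₂ (i , refl))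

  data ClauseNeighbour (c : Fin nclauses) : Vtx φ → Vtx φ → Set where
    inside  : ∀ {u z} → z ∈ Clause c → ClauseNeighbour c u z
    ground  : ClauseNeighbour c (c⊥ c) γ
    via-top : ∀ i {z} → z ∈ Var (var φ (lit c i)) → ClauseNeighbour c (c⊤ c) z
    via-lit : ∀ i {z} → z ∈ Var (var φ (lit c i)) → ClauseNeighbour c (cL c i) z

  Edge1⇒ClauseNeighbour : ∀ {c x u r z} → Edge1 φ u r → u ∈ Clause c → r ∈ Var x → z ∈ Var x →
    ClauseNeighbour c u z
  Edge1⇒ClauseNeighbour (e-lit _ i) (inL _) r∈Var z∈Var =
    via-lit i (subst (λ x → _ ∈ Var x) (sym (rep∈Var⇒var≡ _ r∈Var)) z∈Var)
  Edge1⇒ClauseNeighbour (e-top _ i) in⊤ r∈Var z∈Var =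
    via-top i (subst (λ x → _ ∈ Var x) (sym (rep∈Var⇒var≡ _ r∈Var)) z∈Var)

  clause-neighbour : ∀ {c u z} → u ∈ Clause c → z ~ u → ClauseNeighbour c u z
  clause-neighbour u∈c (inj₁ e) = edge-in u∈c e
    where
    edge-in : ∀ {c u z} → u ∈ Clause c → Edge φ xs ys z u → ClauseNeighbour c u z
    edge-in u∈c (e-clique _ _ _ z∈c' u∈c' _) = inside (subst (λ d → _ ∈ Clause d) (Clause-unique u∈c' u∈c) z∈c')
    edge-in u∈c (e-one _ _ (e-lit c' i))      = ⊥-elim (Var∩Clause-empty (rep∈Var (lit c' i)) u∈c)
    edge-in u∈c (e-one _ _ (e-top c' i))      = ⊥-elim (Var∩Clause-empty (rep∈Var (lit c' i)) u∈c)
    edge-in ()  (e-bot _)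
    edge-in u∈c (e-tx x k j _)                = Edge1⇒ClauseNeighbour (xs-nbr x j) u∈c in₀ (inT k)
    edge-in u∈c (e-ty x k j _)                = Edge1⇒ClauseNeighbour (ys-nbr x j) u∈c in₁ (inT k)
  clause-neighbour u∈c (inj₂ e) = edge-out u∈c e
    where
    edge-out : ∀ {c u z} → u ∈ Clause c → Edge φ xs ys u z → ClauseNeighbour c u z
    edge-out u∈c (e-clique _ _ _ u∈c' z∈c' _) = inside (subst (λ d → _ ∈ Clause d) (Clause-unique u∈c' u∈c) z∈c')
    edge-out u∈c (e-one _ _ e@(e-lit c' i))   = Edge1⇒ClauseNeighbour e u∈c (rep∈Var _) (rep∈Var _)
    edge-out u∈c (e-one _ _ e@(e-top c' i))   = Edge1⇒ClauseNeighbour e u∈c (rep∈Var _) (rep∈Var _)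
    edge-out in⊥ (e-bot _)                    = ground
    edge-out ()  (e-tx _ _ _ _)
    edge-out ()  (e-ty _ _ _ _)

  outsider-neighbour : ∀ {c u w} → ClauseNeighbour c u w → w ∉ Clause c → (∀ {x} → w ∉ Var x) → u ≡ c⊥ c
  outsider-neighbour (inside w∈c)      w∉c _     = ⊥-elim (w∉c w∈c)
  outsider-neighbour ground            _   _     = refl
  outsider-neighbour (via-top _ w∈Var) _   w∉Var = ⊥-elim (w∉Var w∈Var)
  outsider-neighbour (via-lit _ w∈Var) _   w∉Var = ⊥-elim (w∉Var w∈Var)

  Var-≁-c⊥ : ∀ {c x y} → y ∈ Var x → ¬ y ~ c⊥ c
  Var-≁-c⊥ y∈Var y~⊥ with clause-neighbour in⊥ y~⊥
  ... | inside y∈c = Var∩Clause-empty y∈Var y∈c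
  Var-≁-c⊥ () _ | ground

  Var-≁-cL : ∀ {c i x y} → y ∈ Var x → var φ (lit c i) ≢ x → ¬ y ~ cL c i
  Var-≁-cL {i = i} y∈Var ne y~l with clause-neighbour (inL i) y~l
  ... | inside y∈c          = Var∩Clause-empty y∈Var y∈c
  ... | via-lit _ y∈Var-lit = ne (Var-unique y∈Var-lit y∈Var)

  Edge1? : ∀ u r → Dec (Edge1 φ u r)
  Edge1? (cL c i) r = map′ (λ { refl → e-lit c i }) (λ { (e-lit _ _) → refl }) (rep φ (lit c i) ≟ r)
  Edge1? (c⊤ c)   r = map′ (λ { (i , refl) → e-top c i }) (λ { (e-top _ i) → i , refl })
                           (any? λ i → rep φ (lit c i) ≟ r)
  Edge1? (v₀ _)   _ = no λ ()
  Edge1? (v₁ _)   _ = no λ ()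
  Edge1? (tr _ _) _ = no λ ()
  Edge1? (c⊥ _)   _ = no λ ()
  Edge1? γ        _ = no λ ()
  Edge1? ι        _ = no λ ()

  Edge-from-Var? : ∀ {x y} → y ∈ Var x → ∀ u → Dec (Edge φ xs ys y u)
  Edge-from-Var? in₀ _ = no λ { (e-clique _ _ _ () _ _) ; (e-one _ _ ()) }
  Edge-from-Var? in₁ _ = no λ { (e-clique _ _ _ () _ _) ; (e-one _ _ ()) }
  Edge-from-Var? {x} (inT k) u = map′ to from
    (any? (λ j → xs x j ≟ u ×-dec toℕ k <? toℕ j + 2 * bOcc φ x)
     ⊎-dec any? (λ j → ys x j ≟ u ×-dec toℕ j ≤? toℕ k))
    where
    Spec : Set
    Spec = (∃[ j ] xs x j ≡ u × toℕ k < toℕ j + 2 * bOcc φ x) ⊎ (∃[ j ] ys x j ≡ u × toℕ j ≤ toℕ k)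
    to : Spec → Edge φ xs ys (tr x k) u
    to (inj₁ (j , refl , lt)) = e-tx x k j lt
    to (inj₂ (j , refl , le)) = e-ty x k j le
    from : Edge φ xs ys (tr x k) u → Spec
    from (e-tx _ _ j lt) = inj₁ (j , refl , lt)
    from (e-ty _ _ j le) = inj₂ (j , refl , le)
    from (e-clique _ _ _ () _ _)
    from (e-one _ _ ())

  Edge-Clause-Var⇒Edge1 : ∀ {c x u y} → u ∈ Clause c → y ∈ Var x → Edge φ xs ys u y → Edge1 φ u y
  Edge-Clause-Var⇒Edge1 _  y∈Var (e-clique _ _ _ _ y∈c _) = ⊥-elim (Var∩Clause-empty y∈Var y∈c)
  Edge-Clause-Var⇒Edge1 _  _     (e-one _ _ e)             = e
  Edge-Clause-Var⇒Edge1 _  ()    (e-bot _)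
  Edge-Clause-Var⇒Edge1 () _     (e-tx _ _ _ _)
  Edge-Clause-Var⇒Edge1 () _     (e-ty _ _ _ _)

  Var~Clause? : ∀ {c x y u} → y ∈ Var x → u ∈ Clause c → Dec (y ~ u)
  Var~Clause? {y = y} {u} y∈Var u∈c =
    Edge-from-Var? y∈Var u ⊎-dec map′ (e-one u y) (Edge-Clause-Var⇒Edge1 u∈c y∈Var) (Edge1? u y)

  Var-satisfiable? : ∀ {x} {Q : Pred (Vtx φ) 0ℓ} → (∀ {y} → y ∈ Var x → Dec (y ∈ Q)) →
    Dec (Satisfiable (Var x ∩ Q))
  Var-satisfiable? {x} {Q} Q? = map′ to from (Q? in₀ ⊎-dec Q? in₁ ⊎-dec any? (λ k → Q? (inT k)))
    where
    Spec : Set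
    Spec = v₀ x ∈ Q ⊎ v₁ x ∈ Q ⊎ ∃[ k ] tr x k ∈ Q
    to : Spec → Satisfiable (Var x ∩ Q)
    to (inj₁ q)              = v₀ x , in₀ , q
    to (inj₂ (inj₁ q))       = v₁ x , in₁ , q
    to (inj₂ (inj₂ (k , q))) = tr x k , inT k , q
    from : Satisfiable (Var x ∩ Q) → Spec
    from (_ , in₀ , q)     = inj₁ q
    from (_ , in₁ , q)     = inj₂ (inj₁ q)
    from (_ , inT k , q)   = inj₂ (inj₂ (k , q))

module ClauseTwins (φ : CNF3) (distinct : DistinctVars φ)
  (xs : (x : Fin (CNF3.nvars φ)) → Fin (2 * aOcc φ x) → Vtx φ)
  (ys : (x : Fin (CNF3.nvars φ)) → Fin (2 * bOcc φ x) → Vtx φ)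
  (orderings : ValidOrderings φ xs ys)
  (c : Fin (CNF3.nclauses φ)) (R : Pred (Vtx φ) 0ℓ) (R? : Decidable R) where
  open CNF3 φ
  open Vertices φ
  open Graph φ xs ys orderings
  open SymDiffProperties {Adj = _~_} {R = R}

  Twins : Vtx φ → Vtx φ → Set
  Twins u w = AtMostOne (SymDiff _~_ R u w)

  Twins-swap : ∀ {u w} → Twins u w → Twins w u
  Twins-swap twins p q = twins (SymDiff-swap p) (SymDiff-swap q)

  litVar : Fin 3 → Fin nvars
  litVar i = var φ (lit c i)

  litRep : Fin 3 → Vtx φ
  litRep i = rep φ (lit c i)

  litVar-≢ : ∀ {i j} → i ≢ j → litVar i ≢ litVar j
  litVar-≢ i≢j eq = i≢j (distinct c _ _ eq)

  top~litRep : ∀ i → c⊤ c ~ litRep i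
  top~litRep i = inj₁ (e-one _ _ (e-top c i))

  lit~litRep : ∀ i → cL c i ~ litRep i
  lit~litRep i = inj₁ (e-one _ _ (e-lit c i))

  DominatorsEliminated : Fin 3 → Set
  DominatorsEliminated i =
    ∀ y → y ∈ Var (litVar i) → (∀ z → z ~ litRep i → z ~ y) → y ∉ R

  RemainingNeighbours : Fin nvars → Vtx φ → Pred (Vtx φ) 0ℓ
  RemainingNeighbours x u = Var x ∩ R ∩ (_~ u)

  Empty⇒DominatorsEliminated : ∀ {i u} → u ~ litRep i → Empty (RemainingNeighbours (litVar i) u) →
    DominatorsEliminated i
  Empty⇒DominatorsEliminated u~r empty y y∈Var dominates y∈R =
    empty y (y∈Var , y∈R , ~-sym (dominates _ u~r))

  RemainingNeighbours-private : ∀ {x u u'} → u ∈ Clause c → u' ∈ Clause c →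
    (∀ {y} → y ∈ Var x → ¬ y ~ u') → RemainingNeighbours x u ⊆ SymDiff _~_ R u u'
  RemainingNeighbours-private u∈c u'∈c ≁u' (y∈Var , y∈R , y~u) =
    y∈R , Var≢Clause y∈Var u∈c , Var≢Clause y∈Var u'∈c , inj₁ (y~u , ≁u' y∈Var)

  ground-twins : ∀ {i u} → γ ∈ R → u ∈ Clause c → u ≢ c⊥ c → Twins u (c⊥ c) → u ~ litRep i →
    DominatorsEliminated i
  ground-twins {u = u} γ∈R u∈c u≢⊥ twins u~r = Empty⇒DominatorsEliminated u~r
    (⊆-atMostOne-∌⇒Empty twins γ-private (λ { (() , _) })
      (RemainingNeighbours-private u∈c in⊥ Var-≁-c⊥))
    where
    γ-private : SymDiff _~_ R u (c⊥ c) γ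
    γ-private = γ∈R , ∉∈⇒≢ {P = Clause c} (λ ()) u∈c , (λ ()) ,
      inj₂ (inj₂ (e-bot c) , λ γ~u → u≢⊥ (outsider-neighbour (clause-neighbour u∈c γ~u) (λ ()) (λ ())))

  one-of-two-literals : ∀ {u w j₁ j₂ u₁ u₂} → Twins u w → j₁ ≢ j₂ → u₁ ∈ Clause c →
    u₁ ~ litRep j₁ → u₂ ~ litRep j₂ →
    RemainingNeighbours (litVar j₁) u₁ ⊆ SymDiff _~_ R u w →
    RemainingNeighbours (litVar j₂) u₂ ⊆ SymDiff _~_ R u w →
    ∃[ i ] DominatorsEliminated i
  one-of-two-literals {j₁ = j₁} {j₂} twins j₁≢j₂ u₁∈c u₁~r₁ u₂~r₂ S₁⊆ S₂⊆
    with disjoint-⊆-atMostOne⇒Empty twins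
           (Var-satisfiable? λ y∈Var → R? _ ×-dec Var~Clause? y∈Var u₁∈c) disjoint S₁⊆ S₂⊆
    where
    disjoint : ∀ {y} → y ∈ RemainingNeighbours (litVar j₁) _ → y ∉ RemainingNeighbours (litVar j₂) _
    disjoint (y∈Var₁ , _) (y∈Var₂ , _) = litVar-≢ j₁≢j₂ (Var-unique y∈Var₁ y∈Var₂)
  ... | inj₁ empty₁ = j₁ , Empty⇒DominatorsEliminated u₁~r₁ empty₁
  ... | inj₂ empty₂ = j₂ , Empty⇒DominatorsEliminated u₂~r₂ empty₂

  two-others : (i : Fin 3) → Σ (Fin 3) λ j₁ → Σ (Fin 3) λ j₂ → j₁ ≢ j₂ × j₁ ≢ i × j₂ ≢ i
  two-others zero             = suc zero , suc (suc zero) , (λ ()) , (λ ()) , (λ ())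
  two-others (suc zero)       = zero , suc (suc zero) , (λ ()) , (λ ()) , (λ ())
  two-others (suc (suc zero)) = zero , suc zero , (λ ()) , (λ ()) , (λ ())

  Var-≁-other-lit : ∀ {i j y} → j ≢ i → y ∈ Var (litVar j) → ¬ y ~ cL c i
  Var-≁-other-lit j≢i y∈Var = Var-≁-cL y∈Var (litVar-≢ (j≢i ∘ sym))

  top-literal-twins : ∀ {i} → Twins (c⊤ c) (cL c i) → ∃[ j ] DominatorsEliminated j
  top-literal-twins {i} twins with two-others i
  ... | j₁ , j₂ , j₁≢j₂ , j₁≢i , j₂≢i =
    one-of-two-literals twins j₁≢j₂ in⊤ (top~litRep j₁) (top~litRep j₂)
      (RemainingNeighbours-private in⊤ (inL i) (Var-≁-other-lit j₁≢i))
      (RemainingNeighbours-private in⊤ (inL i) (Var-≁-other-lit j₂≢i))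

  literal-literal-twins : ∀ {i j} → i ≢ j → Twins (cL c i) (cL c j) → ∃[ k ] DominatorsEliminated k
  literal-literal-twins {i} {j} i≢j twins =
    one-of-two-literals twins i≢j (inL i) (lit~litRep i) (lit~litRep j)
      (RemainingNeighbours-private (inL i) (inL j) (Var-≁-other-lit i≢j))
      (SymDiff-swap ∘ RemainingNeighbours-private (inL j) (inL i) (Var-≁-other-lit (i≢j ∘ sym)))

  clause-twins : ∀ {u w} → γ ∈ R → Twins u w → u ∈ Clause c → w ∈ Clause c → u ≢ w →
    ∃[ i ] DominatorsEliminated i
  clause-twins _   _     in⊤     in⊤     u≢w = ⊥-elim (u≢w refl)
  clause-twins γ∈R twins in⊤     in⊥     _   = zero , ground-twins γ∈R in⊤ (λ ()) twins (top~litRep zero)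
  clause-twins _   twins in⊤     (inL _) _   = top-literal-twins twins
  clause-twins γ∈R twins in⊥     in⊤     _   =
    zero , ground-twins γ∈R in⊤ (λ ()) (Twins-swap twins) (top~litRep zero)
  clause-twins _   _     in⊥     in⊥     u≢w = ⊥-elim (u≢w refl)
  clause-twins γ∈R twins in⊥     (inL i) _   =
    i , ground-twins γ∈R (inL i) (λ ()) (Twins-swap twins) (lit~litRep i)
  clause-twins _   twins (inL _) in⊤     _   = top-literal-twins (Twins-swap twins)
  clause-twins γ∈R twins (inL i) in⊥     _   = i , ground-twins γ∈R (inL i) (λ ()) twins (lit~litRep i)
  clause-twins _   twins (inL i) (inL j) u≢w = literal-literal-twins (u≢w ∘ cong (cL c)) twins

  two-literals-avoiding : ∀ x → Σ (Fin 3) λ i₀ → Σ (Fin 3) λ i₁ → i₀ ≢ i₁ × litVar i₀ ≢ x × litVar i₁ ≢ x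
  two-literals-avoiding x with litVar zero Fin.≟ x | litVar (suc zero) Fin.≟ x
  ... | yes refl | _        = suc zero , suc (suc zero) , (λ ()) , litVar-≢ (λ ()) , litVar-≢ (λ ())
  ... | no ≢₀    | yes refl = zero , suc (suc zero) , (λ ()) , ≢₀ , litVar-≢ (λ ())
  ... | no ≢₀    | no ≢₁    = zero , suc zero , (λ ()) , ≢₀ , ≢₁

  module TwinOutsideClause {v w} (Clause⊆R : ∀ {z} → z ∈ Clause c → z ∈ R) (v∈c : v ∈ Clause c)
                     (w∉c : w ∉ Clause c) (twins : Twins v w) where

    missed-private : ∀ {z} → z ∈ Clause c → z ≢ v → ¬ z ~ w → SymDiff _~_ R v w z
    missed-private z∈c z≢v z≁w =
      Clause⊆R z∈c , z≢v , (λ z≡w → w∉c (subst (Clause c) z≡w z∈c)) ,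
      inj₁ (inj₁ (e-clique c _ v z∈c v∈c z≢v) , z≁w)

    three-missed : ∀ {z₁ z₂ z₃} → z₁ ∈ Clause c → z₂ ∈ Clause c → z₃ ∈ Clause c →
      z₁ ≢ z₂ → z₁ ≢ z₃ → z₂ ≢ z₃ → ¬ z₁ ~ w → ¬ z₂ ~ w → ¬ z₃ ~ w → ⊥
    three-missed {z₁} {z₂} z₁∈c z₂∈c z₃∈c z₁≢z₂ z₁≢z₃ z₂≢z₃ z₁≁w z₂≁w z₃≁w with z₁ ≟ v | z₂ ≟ v
    ... | yes refl | _ = z₂≢z₃ (twins (missed-private z₂∈c (z₁≢z₂ ∘ sym) z₂≁w)
                                      (missed-private z₃∈c (z₁≢z₃ ∘ sym) z₃≁w))
    ... | no z₁≢v | yes refl = z₁≢z₃ (twins (missed-private z₁∈c z₁≢v z₁≁w)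
                                            (missed-private z₃∈c (z₂≢z₃ ∘ sym) z₃≁w))
    ... | no z₁≢v | no z₂≢v = z₁≢z₂ (twins (missed-private z₁∈c z₁≢v z₁≁w)
                                           (missed-private z₂∈c z₂≢v z₂≁w))

    impossible : ⊥
    impossible with Var-or-not w
    ... | inj₂ w∉Var =
      three-missed in⊤ (inL zero) (inL (suc zero)) (λ ()) (λ ()) (λ ())
        (≁w in⊤ (λ ())) (≁w (inL zero) (λ ())) (≁w (inL (suc zero)) (λ ()))
      where
      ≁w : ∀ {u} → u ∈ Clause c → u ≢ c⊥ c → ¬ u ~ w
      ≁w u∈c u≢⊥ u~w = u≢⊥ (outsider-neighbour (clause-neighbour u∈c (~-sym u~w)) w∉c w∉Var)
    ... | inj₁ (x , w∈Var) with two-literals-avoiding x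
    ... | i₀ , i₁ , i₀≢i₁ , ≢₀ , ≢₁ =
      three-missed in⊥ (inL i₀) (inL i₁) (λ ()) (λ ()) (i₀≢i₁ ∘ cL-injective)
        (Var-≁-c⊥ w∈Var ∘ ~-sym) (Var-≁-cL w∈Var ≢₀ ∘ ~-sym) (Var-≁-cL w∈Var ≢₁ ∘ ~-sym)

  twin-of-clause-vertex : ∀ {v w} → (∀ {z} → z ∈ Clause c → z ∈ R) → γ ∈ R → v ∈ Clause c →
    OneTwins _~_ R v w → ∃[ i ] DominatorsEliminated i
  twin-of-clause-vertex {w = w} Clause⊆R γ∈R v∈c one-twins@(_ , _ , v≢w , _) with Clause? c w
  ... | yes w∈c = clause-twins γ∈R (OneTwins⇒AtMostOne one-twins) v∈c w∈c v≢w
  ... | no w∉c  = ⊥-elim (TwinOutsideClause.impossible Clause⊆R v∈c w∉c (OneTwins⇒AtMostOne one-twins))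

lemma6p3 :
    (φ : CNF3) → DistinctVars φ → OccursTwoOrThree φ →
    (xs : (x : Fin (CNF3.nvars φ)) → Fin (2 * aOcc φ x) → Vtx φ) →
    (ys : (x : Fin (CNF3.nvars φ)) → Fin (2 * bOcc φ x) → Vtx φ) →
    ValidOrderings φ xs ys →
    (rank : Vtx φ → ℕ) → IsEliminationOrder (Adj φ xs ys) rank →
    (c : Fin (CNF3.nclauses φ)) →
    (v : Vtx φ) → InClause φ c v → (∀ w → InClause φ c w → rank v ≤ rank w) →
    rank (γ {φ}) < rank v
    ⊎ ∃[ i ] (∀ y → InVar φ (var φ (CNF3.lit φ c i)) y →
                 (∀ z → Adj φ xs ys z (rep φ (CNF3.lit φ c i)) → Adj φ xs ys z y) →
                 rank y < rank v)
lemma6p3 φ distinct _ xs ys orderings rank (rank-injective , has-twin) c v v∈c v-first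
  with rank γ <? rank v
... | yes γ≺v = inj₁ γ≺v
... | no γ⊀v  = inj₂ (map₂ (λ eliminated y y∈Var dominates → ≰⇒> (eliminated y y∈Var dominates))
                       (twin-of-clause-vertex (v-first _) (≮⇒≥ γ⊀v) v∈c (proj₂ (has-twin v later))))
  where
  open Graph φ xs ys orderings using (Clause-other)
  open ClauseTwins φ distinct xs ys orderings c (λ z → rank v ≤ rank z) (λ z → rank v ≤? rank z)

  later : ∃[ z ] rank v < rank z
  later with Clause-other v∈c
  ... | z , z∈c , z≢v = z , ≤∧≢⇒< (v-first z z∈c) (z≢v ∘ sym ∘ rank-injective v z)
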